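{- Let $m,n\in\mathbb{N}$ with $m\ge 3$ and $n\ge m$. Let $S_n$ be the symmetric group on $\{a_1,\dots,a_n\}$ and let $H_m\subseteq S_n$ be the subgroup generated by all $m$-cycles. Put $$d=\begin{cases} m-2 & \text{if } m \text{ is odd},\\ 3\left(\tfrac{m}{2}-1\right) & \text{if } m \text{ is even},\end{cases}$$ and let $S_{n+d}$ be the symmetric group on $\{a_1,\dots,a_n\}\cup\{x_1,\dots,x_d\}$ (the $x_j$ being new points), with $S_n\subseteq S_{n+d}$ as the permutations fixing every $x_j$. If $\sigma\in H_m$, then there exist $\mu_1,\dots,\mu_r\in S_{n+d}\setminus S_n$ such that each $\mu_i$ is an $m$-cycle, the sets of $m$ elements moved by $\mu_1,\dots,\mu_r$ are pairwise distinct, and $\sigma^{ -1}=\mu_1\cdots\mu_r$.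
   Context: $S_{n+d}\setminus S_n$ consists of the permutations of $\{a_1,\dots,a_n,x_1,\dots,x_d\}$ that move at least one of the points $x_1,\dots,x_d$. Products of permutations are compositions, the rightmost factor applied first. -}

module Defs where

open import Data.Nat using (ℕ; zero; suc; _+_; _*_; _∸_; _/_; _%_)
open import Data.Fin using (Fin; toℕ; _↑ˡ_; _↑ʳ_)
open import Data.Fin.Permutation using (Permutation′; _⟨$⟩ʳ_; _∘ₚ_; flip; id; _≈_)
open import Data.Product using (Σ; ∃; _×_)
open import Relation.Binary.PropositionalEquality using (_≡_; _≢_)
open import Relation.Nullary using (¬_)
open import Function.Definitions using (Injective)
open import Function.Bundles using (_⇔_)

-- Products are compositions, the rightmost factor applied first:
-- (σ · τ) x = σ (τ x).
infixl 7 _·_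
_·_ : ∀ {n} → Permutation′ n → Permutation′ n → Permutation′ n
σ · τ = τ ∘ₚ σ

_⁻¹ : ∀ {n} → Permutation′ n → Permutation′ n
σ ⁻¹ = flip σ

Moves : ∀ {N} → Permutation′ N → Fin N → Set
Moves σ x = σ ⟨$⟩ʳ x ≢ x

IsCycle : ℕ → ∀ {N} → Permutation′ N → Set
IsCycle m {N} σ =
  Σ (Fin m → Fin N) λ c →
      Injective _≡_ _≡_ c
    × (∀ (i j : Fin m) → toℕ j ≡ suc (toℕ i) → σ ⟨$⟩ʳ c i ≡ c j)
    × (∀ (i j : Fin m) → suc (toℕ i) ≡ m → toℕ j ≡ 0 → σ ⟨$⟩ʳ c i ≡ c j)
    × (∀ (x : Fin N) → (∀ i → c i ≢ x) → σ ⟨$⟩ʳ x ≡ x)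

data InH (m : ℕ) {n : ℕ} : Permutation′ n → Set where
  gen  : ∀ {σ} → IsCycle m σ → InH m σ
  one  : InH m id
  mul  : ∀ {σ τ} → InH m σ → InH m τ → InH m (σ · τ)
  inv  : ∀ {σ} → InH m σ → InH m (σ ⁻¹)
  resp : ∀ {σ τ} → σ ≈ τ → InH m σ → InH m τ

dOf : ℕ → ℕ
dOf m with m % 2
... | zero  = 3 * (m / 2 ∸ 1)
... | suc _ = m ∸ 2

-- Points of S_{n+d}: Fin (n + d); a_i = inject+ d i, x_j = n ↑ʳ j.
-- μ ∈ S_{n+d} \ S_n : μ moves some x_j
NotInSn : ∀ n d → Permutation′ (n + d) → Set
NotInSn n d μ = ∃ λ (j : Fin d) → Moves μ (n ↑ʳ j)

prodApp : ∀ {N} (r : ℕ) → (Fin r → Permutation′ N) → Fin N → Fin N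
prodApp zero    μ x = x
prodApp (suc r) μ x = μ Fin.zero ⟨$⟩ʳ prodApp r (λ i → μ (Fin.suc i)) x
  where import Data.Fin as Fin

SameSupport : ∀ {N} → Permutation′ N → Permutation′ N → Set
SameSupport μ ν = ∀ x → Moves μ x ⇔ Moves ν x

-- For odd m every m-cycle is an even permutation, so σ (and σ⁻¹) is even; for even m no
-- condition on σ is needed.  Put π = σ⁻¹ and clear its moved points from the top
-- index down.  If a_p is the largest point moved by π and a_q = π a_p (so q < p), one peels off
-- a "gadget", a product of m-cycles through new points realising
--   • for odd m the 3-cycle (a_o a_p a_q) with o < p, o ≠ q, as a product of two m-cycles,
--   • for even m the transposition (a_p a_q), as a product of three m-cycles,
-- and continues with τ⁻¹ π, which fixes a_p and everything above it.  Every cycle of the gadget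
-- at a_p moves a_p, which no later cycle does, so supports of different gadgets differ; inside a
-- gadget the cycles are told apart by explicit points.  For odd m the descent cannot get stuck at
-- a transposition (a₀ a₁), since π stays even.
module Submission where

open import Defs
open import Data.Nat using (ℕ; zero; suc; _+_; _*_; _∸_; _≤_; _<_; z≤n; s≤s; _%_; _/_)
import Data.Nat.Properties as ℕ
open import Data.Nat.DivMod using (m≡m%n+[m/n]*n; m%n<n)
open import Data.Bool using (Bool; true; false; not; _xor_)
open import Data.Bool.Properties
  using (xor-∧-commutativeRing; xor-annihilates-not; not-involutive; xor-same; xor-identityʳ)
  renaming (_≟_ to _≟ᵇ_)
open import Data.Fin
  using (Fin; zero; suc; toℕ; punchOut; punchIn; inject₁; fromℕ; fromℕ<; lower₁; opposite; _↑ˡ_; _↑ʳ_;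
         splitAt; join; combine; remQuot)
open import Data.Fin.Patterns using (0F; 1F; 2F)
open import Data.Fin.Properties
  using (_≟_; any?; punchOut-cong; punchIn-punchOut; toℕ-injective; toℕ-inject₁; toℕ-fromℕ; toℕ-fromℕ<;
         inject₁-injective; inject₁-lower₁; toℕ<n; opposite-involutive; toℕ-↑ˡ; toℕ-↑ʳ; ↑ˡ-injective;
         ↑ʳ-injective; join-splitAt; combine-injectiveˡ; combine-injectiveʳ; combine-remQuot)
open import Data.Fin.Relation.Unary.Top using (view; ‵fromℕ; ‵inj₁)
open import Data.Fin.Permutation
  using (Permutation′; _⟨$⟩ʳ_; _⟨$⟩ˡ_; _∘ₚ_; flip; _≈_; permutation; remove; transpose; insert;
         inverseˡ; inverseʳ; insert-punchIn)
  renaming (id to idₚ)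
open import Data.Vec using (Vec; []; _∷_; _++_; lookup; tabulate; map; head; last)
open import Data.Vec.Properties using (lookup∘tabulate)
import Data.Vec.Functional as Vector
open import Data.Vec.Membership.Propositional using (_∈_; _∉_)
open import Data.Vec.Membership.Propositional.Properties using (∈-lookup)
open import Data.Vec.Relation.Unary.Any as Any using (here; there; index; satisfied)
import Data.Vec.Relation.Unary.Any.Properties as Anyₚ
open import Data.Vec.Relation.Unary.All using (_∷_; universal)
import Data.Vec.Relation.Unary.All.Properties as Allₚ
open import Data.Vec.Relation.Unary.AllPairs using (_∷_)
import Data.Vec.Relation.Unary.AllPairs.Properties as AllPairsₚ
open import Data.Vec.Relation.Unary.Unique.Propositional using (Unique)
import Data.Vec.Relation.Unary.Unique.Propositional.Properties as Uniqueₚ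
open import Data.Product using (Σ; ∃; _×_; _,_; proj₁; proj₂)
open import Data.Sum using (_⊎_; inj₁; inj₂; [_,_]′)
open import Data.Sum.Properties using ([,]-map)
open import Data.Unit using (⊤; tt)
open import Data.Empty using (⊥-elim)
open import Function using (id; _∘_)
open import Function.Bundles using (mk⇔; Equivalence)
open import Function.Definitions using (Injective)
open import Relation.Binary using (tri<; tri≈; tri>)
open import Relation.Binary.PropositionalEquality
open import Relation.Nullary using (¬_; Dec; yes; no; decidable-stable)
open import Algebra.Solver.Ring.AlmostCommutativeRing using (fromCommutativeRing)
import Algebra.Solver.Ring.Simple as RingSolver

module BoolSolver = RingSolver (fromCommutativeRing xor-∧-commutativeRing) _≟ᵇ_

transpose-≡ˡ : ∀ {n} (i j : Fin n) → transpose i j ⟨$⟩ʳ i ≡ j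
transpose-≡ˡ i j with i ≟ i
... | yes _   = refl
... | no i≢i = ⊥-elim (i≢i refl)

transpose-≡ʳ : ∀ {n} (i j : Fin n) → transpose i j ⟨$⟩ʳ j ≡ i
transpose-≡ʳ i j with j ≟ i
... | yes j≡i = j≡i
... | no _ with j ≟ j
...   | yes _   = refl
...   | no j≢j = ⊥-elim (j≢j refl)

transpose-≢ : ∀ {n} {i j k : Fin n} → k ≢ i → k ≢ j → transpose i j ⟨$⟩ʳ k ≡ k
transpose-≢ {i = i} {j} {k} k≢i k≢j with k ≟ i
... | yes k≡i = ⊥-elim (k≢i k≡i)
... | no _ with k ≟ j
...   | yes k≡j = ⊥-elim (k≢j k≡j)
...   | no _    = refl

⟨$⟩ʳ-injective : ∀ {n} (π : Permutation′ n) {x y} → π ⟨$⟩ʳ x ≡ π ⟨$⟩ʳ y → x ≡ y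
⟨$⟩ʳ-injective π eq = trans (sym (inverseˡ π)) (trans (cong (π ⟨$⟩ˡ_) eq) (inverseˡ π))

-- Parity of permutations

isOdd : ℕ → Bool
isOdd zero    = false
isOdd (suc n) = not (isOdd n)

isOddFin : ∀ {n} → Fin n → Bool
isOddFin = isOdd ∘ toℕ

-- true for odd permutations, by expansion along the first row:
-- sgn π = (-1)^{π 0} · sgn (π with 0 and π 0 deleted).
parity : ∀ {n} → Permutation′ n → Bool
parity {zero}  π = false
parity {suc n} π = isOddFin (π ⟨$⟩ʳ zero) xor parity (remove zero π)

punchOut-cong₂ : ∀ {n} {i i′ j j′ : Fin (suc n)} (i≢j : i ≢ j) (i′≢j′ : i′ ≢ j′) →
                 i ≡ i′ → j ≡ j′ → punchOut i≢j ≡ punchOut i′≢j′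
punchOut-cong₂ {i = i} _ _ refl refl = punchOut-cong i refl

parity-cong : ∀ {n} {π ρ : Permutation′ n} → π ≈ ρ → parity π ≡ parity ρ
parity-cong {zero}  π≈ρ = refl
parity-cong {suc n} π≈ρ = cong₂ _xor_ (cong isOddFin (π≈ρ zero))
  (parity-cong λ j → punchOut-cong₂ _ _ (π≈ρ zero) (π≈ρ (suc j)))

parity-id : ∀ {n} → parity (idₚ {n}) ≡ false
parity-id {zero}  = refl
parity-id {suc n} = trans (parity-cong {π = remove zero (idₚ {suc n})} {ρ = idₚ {n}} λ _ → refl) (parity-id {n})

-- Deleting the points u and v of Fin (2 + n), in either order, renames w in the same way.
punchOut-comm : ∀ {n} (u v w : Fin (suc (suc n)))
  (u≢v : u ≢ v) (u≢w : u ≢ w) (v≢u : v ≢ u) (v≢w : v ≢ w)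
  (p : punchOut u≢v ≢ punchOut u≢w) (q : punchOut v≢u ≢ punchOut v≢w) →
  punchOut p ≡ punchOut q
punchOut-comm zero zero w u≢v _ _ _ _ _ = ⊥-elim (u≢v refl)
punchOut-comm zero (suc v) zero _ u≢w _ _ _ _ = ⊥-elim (u≢w refl)
punchOut-comm {zero} zero (suc zero) (suc zero) _ _ _ v≢w _ _ = ⊥-elim (v≢w refl)
punchOut-comm {suc n} zero (suc v) (suc w) _ _ _ _ _ _ = punchOut-cong v refl
punchOut-comm (suc u) zero zero _ _ _ v≢w _ _ = ⊥-elim (v≢w refl)
punchOut-comm {zero} (suc zero) zero (suc zero) _ u≢w _ _ _ _ = ⊥-elim (u≢w refl)
punchOut-comm {suc n} (suc u) zero (suc w) _ _ _ _ _ _ = punchOut-cong u refl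
punchOut-comm {zero} (suc zero) (suc zero) w u≢v _ _ _ _ _ = ⊥-elim (u≢v refl)
punchOut-comm {suc n} (suc u) (suc v) zero _ _ _ _ _ _ = refl
punchOut-comm {suc n} (suc u) (suc v) (suc w) u≢v u≢w v≢u v≢w _ _ =
  cong suc (punchOut-comm u v w (u≢v ∘ cong suc) (u≢w ∘ cong suc) (v≢u ∘ cong suc) (v≢w ∘ cong suc) _ _)

-- Of u and v, exactly the larger one is shifted down by deleting the other.
isOdd-punchOut : ∀ {n} (u v : Fin (suc n)) (u≢v : u ≢ v) (v≢u : v ≢ u) →
  isOddFin (punchOut u≢v) xor isOddFin (punchOut v≢u) ≡ not (isOddFin u xor isOddFin v)
isOdd-punchOut zero zero u≢v _ = ⊥-elim (u≢v refl)
isOdd-punchOut {suc n} zero (suc v) _ _ with isOddFin v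
... | true  = refl
... | false = refl
isOdd-punchOut {suc n} (suc u) zero _ _ with isOddFin u
... | true  = refl
... | false = refl
isOdd-punchOut {suc n} (suc u) (suc v) u≢v v≢u = begin
  not a xor not b                             ≡⟨ xor-annihilates-not a b ⟩
  a xor b                                     ≡⟨ isOdd-punchOut u v _ _ ⟩
  not (isOddFin u xor isOddFin v)             ≡⟨ cong not (xor-annihilates-not (isOddFin u) (isOddFin v)) ⟨
  not (not (isOddFin u) xor not (isOddFin v)) ∎
  where
  open ≡-Reasoning
  a = isOddFin (punchOut {i = u} {j = v} (u≢v ∘ cong suc))
  b = isOddFin (punchOut {i = v} {j = u} (v≢u ∘ cong suc))

xor-exchange : ∀ a b c d k y → c xor d ≡ not (a xor b) →
               a xor (k xor (c xor y)) ≡ not k xor (b xor (d xor y))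
xor-exchange a b c d k y c⊕d≡¬[a⊕b] = begin
  a xor (k xor (c xor y))
    ≡⟨ solve 6 (λ a b c d k y → a :+ (k :+ (c :+ y))
                 := ((con true :+ k) :+ (b :+ (d :+ y))) :+ ((c :+ d) :+ (con true :+ (a :+ b)))) refl a b c d k y ⟩
  rhs xor ((c xor d) xor not (a xor b))        ≡⟨ cong (λ e → rhs xor (e xor not (a xor b))) c⊕d≡¬[a⊕b] ⟩
  rhs xor (not (a xor b) xor not (a xor b))    ≡⟨ cong (rhs xor_) (xor-same (not (a xor b))) ⟩
  rhs xor false                                ≡⟨ xor-identityʳ rhs ⟩
  rhs                                          ∎
  where
  open ≡-Reasoning
  open BoolSolver
  rhs = not k xor (b xor (d xor y))

parity-expand : ∀ {n} (π : Permutation′ (suc n)) (k : Fin (suc n)) →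
  parity π ≡ isOddFin k xor (isOddFin (π ⟨$⟩ʳ k) xor parity (remove k π))
parity-expand π zero = refl
parity-expand {suc n} π (suc k) = begin
  a xor parity (remove zero π)
    ≡⟨ cong (a xor_) (parity-expand (remove zero π) k) ⟩
  a xor (isOddFin k xor (c xor parity (remove k (remove zero π))))
    ≡⟨ cong (λ z → a xor (isOddFin k xor (c xor z)))
            (parity-cong λ j → punchOut-comm (π ⟨$⟩ʳ zero) (π ⟨$⟩ʳ suc k) (π ⟨$⟩ʳ suc (punchIn k j)) _ _ _ _ _ _) ⟩
  a xor (isOddFin k xor (c xor y))
    ≡⟨ xor-exchange a b c d (isOddFin k) y (isOdd-punchOut (π ⟨$⟩ʳ zero) (π ⟨$⟩ʳ suc k) _ _) ⟩
  not (isOddFin k) xor (b xor (d xor y)) ∎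
  where
  open ≡-Reasoning
  a = isOddFin (π ⟨$⟩ʳ zero)
  b = isOddFin (π ⟨$⟩ʳ suc k)
  c = isOddFin (remove zero π ⟨$⟩ʳ k)
  d = isOddFin (remove (suc k) π ⟨$⟩ʳ zero)
  y = parity (remove zero (remove (suc k) π))

parity-∘ : ∀ {n} (π ρ : Permutation′ n) → parity (π ∘ₚ ρ) ≡ parity π xor parity ρ
parity-∘ {zero}  π ρ = refl
parity-∘ {suc n} π ρ = begin
  c xor parity (remove zero (π ∘ₚ ρ))
    ≡⟨ cong (c xor_) (parity-cong {π = remove zero (π ∘ₚ ρ)} {ρ = remove zero π ∘ₚ remove (π ⟨$⟩ʳ zero) ρ}
         λ j → punchOut-cong₂ {i = ρ ⟨$⟩ʳ (π ⟨$⟩ʳ zero)} {i′ = ρ ⟨$⟩ʳ (π ⟨$⟩ʳ zero)} _ _ refl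
                 (cong (ρ ⟨$⟩ʳ_) (sym (punchIn-punchOut _)))) ⟩
  c xor parity (remove zero π ∘ₚ remove (π ⟨$⟩ʳ zero) ρ)
    ≡⟨ cong (c xor_) (parity-∘ (remove zero π) (remove (π ⟨$⟩ʳ zero) ρ)) ⟩
  c xor (parity (remove zero π) xor parity (remove (π ⟨$⟩ʳ zero) ρ))
    ≡⟨ solve 4 (λ a c x y → c :+ (x :+ y) := (a :+ x) :+ (a :+ (c :+ y))) refl a c _ _ ⟩
  (a xor parity (remove zero π)) xor (a xor (c xor parity (remove (π ⟨$⟩ʳ zero) ρ)))
    ≡⟨ cong ((a xor parity (remove zero π)) xor_) (parity-expand ρ (π ⟨$⟩ʳ zero)) ⟨
  parity π xor parity ρ ∎
  where
  open ≡-Reasoning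
  open BoolSolver
  a = isOddFin (π ⟨$⟩ʳ zero)
  c = isOddFin (ρ ⟨$⟩ʳ (π ⟨$⟩ʳ zero))

parity-flip : ∀ {n} (π : Permutation′ n) → parity (flip π) ≡ parity π
parity-flip {n} π = begin
  parity (flip π)                             ≡⟨ solve 2 (λ p q → q := p :+ (p :+ q)) refl (parity π) _ ⟩
  parity π xor (parity π xor parity (flip π)) ≡⟨ cong (parity π xor_) (parity-∘ π (flip π)) ⟨
  parity π xor parity (π ∘ₚ flip π)           ≡⟨ cong (parity π xor_) (parity-cong {ρ = idₚ {n}} λ _ → inverseˡ π) ⟩
  parity π xor parity (idₚ {n})               ≡⟨ cong (parity π xor_) (parity-id {n}) ⟩
  parity π xor false                          ≡⟨ xor-identityʳ (parity π) ⟩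
  parity π                                    ∎
  where
  open ≡-Reasoning
  open BoolSolver

module _ {n} {i j : Fin (suc (suc n))} (i≢j : i ≢ j) where

  -- sends 0 to i and 1 to j
  sending₀₁ : Permutation′ (suc (suc n))
  sending₀₁ = insert zero i (insert zero (punchOut i≢j) idₚ)

  private
    ρ = sending₀₁
    t₀₁ = transpose {suc (suc n)} zero (suc zero)

    ρ1≡j : ρ ⟨$⟩ʳ suc zero ≡ j
    ρ1≡j = trans (insert-punchIn zero i (insert zero (punchOut i≢j) idₚ) zero) (punchIn-punchOut i≢j)

    ρ⁻¹j≡1 : ρ ⟨$⟩ˡ j ≡ suc zero
    ρ⁻¹j≡1 = trans (cong (ρ ⟨$⟩ˡ_) (sym ρ1≡j)) (inverseˡ ρ)

  transpose-conjugate : transpose i j ≈ flip ρ ∘ₚ (t₀₁ ∘ₚ ρ)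
  transpose-conjugate x = by-cases (x ≟ i) (x ≟ j)
    where
    open ≡-Reasoning
    by-cases : Dec (x ≡ i) → Dec (x ≡ j) → transpose i j ⟨$⟩ʳ x ≡ ρ ⟨$⟩ʳ (t₀₁ ⟨$⟩ʳ (ρ ⟨$⟩ˡ x))
    by-cases (yes refl) _ = begin
      transpose x j ⟨$⟩ʳ x              ≡⟨ transpose-≡ˡ x j ⟩
      j                                 ≡⟨ ρ1≡j ⟨
      ρ ⟨$⟩ʳ suc zero                   ≡⟨ cong (λ z → ρ ⟨$⟩ʳ (t₀₁ ⟨$⟩ʳ z)) (inverseˡ ρ {zero}) ⟨
      ρ ⟨$⟩ʳ (t₀₁ ⟨$⟩ʳ (ρ ⟨$⟩ˡ x))       ∎
    by-cases (no _) (yes refl) = begin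
      transpose i x ⟨$⟩ʳ x              ≡⟨ transpose-≡ʳ i x ⟩
      ρ ⟨$⟩ʳ zero                       ≡⟨ cong (λ z → ρ ⟨$⟩ʳ (t₀₁ ⟨$⟩ʳ z)) ρ⁻¹j≡1 ⟨
      ρ ⟨$⟩ʳ (t₀₁ ⟨$⟩ʳ (ρ ⟨$⟩ˡ x))       ∎
    by-cases (no x≢i) (no x≢j) = begin
      transpose i j ⟨$⟩ʳ x              ≡⟨ transpose-≢ x≢i x≢j ⟩
      x                                 ≡⟨ inverseʳ ρ ⟨
      ρ ⟨$⟩ʳ (ρ ⟨$⟩ˡ x)                  ≡⟨ cong (ρ ⟨$⟩ʳ_) (transpose-≢ ρ⁻¹x≢0 ρ⁻¹x≢1) ⟨
      ρ ⟨$⟩ʳ (t₀₁ ⟨$⟩ʳ (ρ ⟨$⟩ˡ x))       ∎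
      where
      ρ⁻¹x≢0 : ρ ⟨$⟩ˡ x ≢ zero
      ρ⁻¹x≢0 eq = x≢i (trans (sym (inverseʳ ρ)) (cong (ρ ⟨$⟩ʳ_) eq))
      ρ⁻¹x≢1 : ρ ⟨$⟩ˡ x ≢ suc zero
      ρ⁻¹x≢1 eq = x≢j (trans (sym (inverseʳ ρ)) (trans (cong (ρ ⟨$⟩ʳ_) eq) ρ1≡j))

parity-transpose : ∀ {n} {i j : Fin n} → i ≢ j → parity (transpose i j) ≡ true
parity-transpose {suc zero} {zero} {zero} i≢j = ⊥-elim (i≢j refl)
parity-transpose {suc (suc n)} {i} {j} i≢j = begin
  parity (transpose i j)                    ≡⟨ parity-cong {π = transpose i j} {ρ = flip ρ ∘ₚ (t₀₁ ∘ₚ ρ)} (transpose-conjugate i≢j) ⟩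
  parity (flip ρ ∘ₚ (t₀₁ ∘ₚ ρ))             ≡⟨ parity-∘ (flip ρ) (t₀₁ ∘ₚ ρ) ⟩
  parity (flip ρ) xor parity (t₀₁ ∘ₚ ρ)     ≡⟨ cong₂ _xor_ (parity-flip ρ) (parity-∘ t₀₁ ρ) ⟩
  parity ρ xor (parity t₀₁ xor parity ρ)    ≡⟨ cong (λ t → parity ρ xor (t xor parity ρ)) parity-t₀₁ ⟩
  parity ρ xor (true xor parity ρ)          ≡⟨ solve 1 (λ r → r :+ (con true :+ r) := con true) refl (parity ρ) ⟩
  true                                      ∎
  where
  open ≡-Reasoning
  open BoolSolver
  ρ = sending₀₁ i≢j
  t₀₁ = transpose {suc (suc n)} zero (suc zero)
  parity-t₀₁ : parity t₀₁ ≡ true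
  parity-t₀₁ = cong (true xor_)
    (trans (parity-cong {π = remove zero t₀₁} {ρ = idₚ {suc n}} λ { zero → refl ; (suc _) → refl }) (parity-id {suc n}))

-- Composing the (m+2)-cycle (c₀ … c_m c_{m+1}) with the transposition (c_m c_{m+1})
-- leaves the (m+1)-cycle (c₀ … c_m).
module ShortenCycle {m N} {σ : Permutation′ N} (cyc : IsCycle (suc (suc m)) σ) where

  private
    c = proj₁ cyc
    c-injective = proj₁ (proj₂ cyc)
    step = proj₁ (proj₂ (proj₂ cyc))
    wrap = proj₁ (proj₂ (proj₂ (proj₂ cyc)))
    fix = proj₂ (proj₂ (proj₂ (proj₂ cyc)))

    penult ult : Fin (suc (suc m))
    penult = inject₁ (fromℕ m)
    ult = fromℕ (suc m)

    toℕ-penult : toℕ penult ≡ m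
    toℕ-penult = trans (toℕ-inject₁ (fromℕ m)) (toℕ-fromℕ m)

  a b : Fin N
  a = c penult
  b = c ult

  a≢b : a ≢ b
  a≢b a≡b = ℕ.1+n≢n (sym (trans (sym toℕ-penult) (trans (cong toℕ (c-injective a≡b)) (toℕ-fromℕ (suc m)))))

  private
    τσ = transpose a b ∘ₚ σ

    inner≢a : ∀ (i : Fin (suc m)) → toℕ i ≢ m → c (inject₁ i) ≢ a
    inner≢a i i≢m eq = i≢m (trans (sym (toℕ-inject₁ i)) (trans (cong toℕ (c-injective eq)) toℕ-penult))

    inner≢b : ∀ (i : Fin (suc m)) → c (inject₁ i) ≢ b
    inner≢b i eq = ℕ.<⇒≢ (toℕ<n i) (trans (sym (toℕ-inject₁ i)) (trans (cong toℕ (c-injective eq)) (toℕ-fromℕ (suc m))))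

    step′ : ∀ (i j : Fin (suc m)) → toℕ j ≡ suc (toℕ i) → τσ ⟨$⟩ʳ c (inject₁ i) ≡ c (inject₁ j)
    step′ i j j≡1+i = trans (cong (σ ⟨$⟩ʳ_) (transpose-≢ (inner≢a i i≢m) (inner≢b i)))
      (step (inject₁ i) (inject₁ j) (trans (toℕ-inject₁ j) (trans j≡1+i (cong suc (sym (toℕ-inject₁ i))))))
      where
      i≢m : toℕ i ≢ m
      i≢m i≡m = ℕ.<⇒≢ (toℕ<n j) (trans j≡1+i (cong suc i≡m))

    wrap′ : ∀ (i j : Fin (suc m)) → suc (toℕ i) ≡ suc m → toℕ j ≡ 0 → τσ ⟨$⟩ʳ c (inject₁ i) ≡ c (inject₁ j)
    wrap′ i j 1+i≡1+m j≡0 = begin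
      σ ⟨$⟩ʳ (transpose a b ⟨$⟩ʳ c (inject₁ i)) ≡⟨ cong (λ k → σ ⟨$⟩ʳ (transpose a b ⟨$⟩ʳ c k)) i≡penult ⟩
      σ ⟨$⟩ʳ (transpose a b ⟨$⟩ʳ a)             ≡⟨ cong (σ ⟨$⟩ʳ_) (transpose-≡ˡ a b) ⟩
      σ ⟨$⟩ʳ b                                  ≡⟨ wrap ult (inject₁ j) (cong suc (toℕ-fromℕ (suc m))) (trans (toℕ-inject₁ j) j≡0) ⟩
      c (inject₁ j)                             ∎
      where
      open ≡-Reasoning
      i≡penult : inject₁ i ≡ penult
      i≡penult = toℕ-injective (trans (toℕ-inject₁ i) (trans (ℕ.suc-injective 1+i≡1+m) (sym toℕ-penult)))

    fix′ : ∀ x → (∀ i → c (inject₁ i) ≢ x) → τσ ⟨$⟩ʳ x ≡ x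
    fix′ x x∉inner with x ≟ b
    ... | yes refl = trans (cong (σ ⟨$⟩ʳ_) (transpose-≡ʳ a x))
                           (step penult ult (trans (toℕ-fromℕ (suc m)) (cong suc (sym toℕ-penult))))
    ... | no x≢b   = trans (cong (σ ⟨$⟩ʳ_) (transpose-≢ (λ x≡a → x∉inner (fromℕ m) (sym x≡a)) x≢b)) (fix x x∉c)
      where
      x∉c : ∀ i → c i ≢ x
      x∉c i with toℕ i ℕ.≟ suc m
      ... | yes i≡ult = λ cᵢ≡x →
        x≢b (trans (sym cᵢ≡x) (cong c (toℕ-injective (trans i≡ult (sym (toℕ-fromℕ (suc m)))))))
      ... | no i≢ult  = λ cᵢ≡x →
        x∉inner (lower₁ i (i≢ult ∘ sym)) (trans (cong c (inject₁-lower₁ i (i≢ult ∘ sym))) cᵢ≡x)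

  shortened : IsCycle (suc m) (transpose a b ∘ₚ σ)
  shortened = c ∘ inject₁ , inject₁-injective ∘ c-injective , step′ , wrap′ , fix′

parity-cycle : ∀ m {N} {σ : Permutation′ N} → IsCycle (suc m) σ → parity σ ≡ isOdd m
parity-cycle zero {N} {σ} (c , _ , _ , wrap , fix) = trans (parity-cong {ρ = idₚ} fixes-all) (parity-id {N})
  where
  fixes-all : ∀ x → σ ⟨$⟩ʳ x ≡ x
  fixes-all x with c zero ≟ x
  ... | yes refl = wrap zero zero refl refl
  ... | no c₀≢x  = fix x λ { zero → c₀≢x }
parity-cycle (suc m) {σ = σ} cyc = begin
  parity σ                                  ≡⟨ not-involutive (parity σ) ⟨
  not (true xor parity σ)                   ≡⟨ cong (λ t → not (t xor parity σ)) (parity-transpose a≢b) ⟨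
  not (parity (transpose a b) xor parity σ) ≡⟨ cong not (parity-∘ (transpose a b) σ) ⟨
  not (parity (transpose a b ∘ₚ σ))         ≡⟨ cong not (parity-cycle m {σ = transpose a b ∘ₚ σ} shortened) ⟩
  not (isOdd m)                             ∎
  where
  open ≡-Reasoning
  open ShortenCycle {m} {σ = σ} cyc

data Adjacent {A : Set} (x y : A) : ∀ {n} → Vec A n → Set where
  here  : ∀ {n} {zs : Vec A n} → Adjacent x y (x ∷ y ∷ zs)
  there : ∀ {n z} {zs : Vec A n} → Adjacent x y zs → Adjacent x y (z ∷ zs)

module _ {A : Set} where

  Adjacent-index : ∀ {k} {x y : A} {xs : Vec A (suc k)} → Adjacent x y xs →
                   Σ (Fin k) λ i → lookup xs (inject₁ i) ≡ x × lookup xs (suc i) ≡ y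
  Adjacent-index here = zero , refl , refl
  Adjacent-index {xs = _ ∷ _ ∷ _} (there adj) with Adjacent-index adj
  ... | i , xᵢ≡x , xᵢ₊₁≡y = suc i , xᵢ≡x , xᵢ₊₁≡y

  Adjacent-head : ∀ {k} (x : A) (xs : Vec A (suc k)) → Adjacent x (head xs) (x ∷ xs)
  Adjacent-head x (_ ∷ _) = here

  Adjacent-++ˡ : ∀ {k l} {x y : A} {xs : Vec A k} (ys : Vec A l) → Adjacent x y xs → Adjacent x y (xs ++ ys)
  Adjacent-++ˡ ys here        = here
  Adjacent-++ˡ ys (there adj) = there (Adjacent-++ˡ ys adj)

  Adjacent-++ʳ : ∀ {k l} {x y : A} (xs : Vec A k) {ys : Vec A l} → Adjacent x y ys → Adjacent x y (xs ++ ys)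
  Adjacent-++ʳ []       adj = adj
  Adjacent-++ʳ (_ ∷ xs) adj = there (Adjacent-++ʳ xs adj)

  Adjacent-last-head : ∀ {k l} (xs : Vec A (suc k)) (ys : Vec A (suc l)) → Adjacent (last xs) (head ys) (xs ++ ys)
  Adjacent-last-head (x ∷ [])      (y ∷ ys) = here
  Adjacent-last-head (x ∷ x′ ∷ xs) ys       = there (Adjacent-last-head (x′ ∷ xs) ys)

  Adjacent-junction : ∀ {k l} {x y : A} (xs : Vec A (suc k)) (ys : Vec A (suc l)) →
                      last xs ≡ x → head ys ≡ y → Adjacent x y (xs ++ ys)
  Adjacent-junction xs ys refl refl = Adjacent-last-head xs ys

  Adjacent-tabulate : ∀ {k} (f : Fin (suc k) → A) (i : Fin k) → Adjacent (f (inject₁ i)) (f (suc i)) (tabulate f)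
  Adjacent-tabulate f zero    = here
  Adjacent-tabulate f (suc i) = there (Adjacent-tabulate (f ∘ suc) i)

  Adjacent-map : ∀ {B : Set} (f : A → B) {k} {x y : A} {xs : Vec A k} → Adjacent x y xs → Adjacent (f x) (f y) (map f xs)
  Adjacent-map f here        = here
  Adjacent-map f (there adj) = there (Adjacent-map f adj)

  head-map : ∀ {B : Set} (f : A → B) {k} (xs : Vec A (suc k)) → head (map f xs) ≡ f (head xs)
  head-map f (_ ∷ _) = refl

  lookup-fromℕ : ∀ {k} (xs : Vec A (suc k)) → lookup xs (fromℕ k) ≡ last xs
  lookup-fromℕ (x ∷ [])      = refl
  lookup-fromℕ (x ∷ x′ ∷ xs) = lookup-fromℕ (x′ ∷ xs)

  last-++ : ∀ {k l} (xs : Vec A (suc k)) (ys : Vec A (suc l)) → last (xs ++ ys) ≡ last ys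
  last-++ (x ∷ [])      (y ∷ ys) = refl
  last-++ (x ∷ x′ ∷ xs) ys       = last-++ (x′ ∷ xs) ys

  last-map : ∀ {B : Set} (f : A → B) {k} (xs : Vec A (suc k)) → last (map f xs) ≡ f (last xs)
  last-map f (x ∷ [])      = refl
  last-map f (x ∷ x′ ∷ xs) = last-map f (x′ ∷ xs)

  last-tabulate : ∀ {k} (f : Fin (suc k) → A) → last (tabulate f) ≡ f (fromℕ k)
  last-tabulate {k} f = trans (sym (lookup-fromℕ (tabulate f))) (lookup∘tabulate f (fromℕ k))

  ∉-tabulate : ∀ {k} {f : Fin k → A} {x} → (∀ i → f i ≢ x) → x ∉ tabulate f
  ∉-tabulate f≢x x∈ with Anyₚ.tabulate⁻ x∈
  ... | i , x≡fᵢ = f≢x i (sym x≡fᵢ)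

  ∉-++ : ∀ {k l} {xs : Vec A k} {ys : Vec A l} {x} → x ∉ xs → x ∉ ys → x ∉ xs ++ ys
  ∉-++ {xs = xs} x∉xs x∉ys x∈ with Anyₚ.++⁻ xs x∈
  ... | inj₁ x∈xs = x∉xs x∈xs
  ... | inj₂ x∈ys = x∉ys x∈ys

opposite-inject₁ : ∀ {k} (i : Fin k) → opposite (inject₁ i) ≡ suc (opposite i)
opposite-inject₁ {suc k} zero    = refl
opposite-inject₁ {suc k} (suc i) = cong inject₁ (opposite-inject₁ i)

opposite-injective : ∀ {k} {i j : Fin k} → opposite i ≡ opposite j → i ≡ j
opposite-injective {i = i} {j} eq = trans (sym (opposite-involutive i)) (trans (cong opposite eq) (opposite-involutive j))

opposite-fromℕ : ∀ k → opposite (fromℕ k) ≡ zero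
opposite-fromℕ zero    = refl
opposite-fromℕ (suc k) = cong inject₁ (opposite-fromℕ k)

Adjacent-tabulate-opposite : ∀ {A : Set} {k} (f : Fin (suc k) → A) (i : Fin k) →
                             Adjacent (f (suc i)) (f (inject₁ i)) (tabulate (f ∘ opposite))
Adjacent-tabulate-opposite f i =
  subst₂ (λ x y → Adjacent x y (tabulate (f ∘ opposite)))
         (cong f (trans (opposite-inject₁ (opposite i)) (cong suc (opposite-involutive i))))
         (cong (f ∘ inject₁) (opposite-involutive i))
         (Adjacent-tabulate (f ∘ opposite) (opposite i))

-- Cycles through a vector of distinct points

-- The permutation acting as c ∘ ρ ∘ c⁻¹ on the image of c and as the identity elsewhere.
module Along {m N : ℕ} (c : Fin m → Fin N) (c-injective : Injective _≡_ _≡_ c) where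

  image? : ∀ y → (∃ λ i → c i ≡ y) ⊎ (∀ i → c i ≢ y)
  image? y with any? (λ i → c i ≟ y)
  ... | yes found = inj₁ found
  ... | no ∄i     = inj₂ λ i cᵢ≡y → ∄i (i , cᵢ≡y)

  along : (Fin m → Fin m) → Fin N → Fin N
  along f y with image? y
  ... | inj₁ (i , _) = c (f i)
  ... | inj₂ _       = y

  along-image : ∀ f i → along f (c i) ≡ c (f i)
  along-image f i with image? (c i)
  ... | inj₁ (j , cⱼ≡cᵢ) = cong (c ∘ f) (c-injective cⱼ≡cᵢ)
  ... | inj₂ c∌cᵢ        = ⊥-elim (c∌cᵢ i refl)

  along-outside : ∀ f {y} → (∀ i → c i ≢ y) → along f y ≡ y
  along-outside f {y} c∌y with image? y
  ... | inj₁ (i , cᵢ≡y) = ⊥-elim (c∌y i cᵢ≡y)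
  ... | inj₂ _          = refl

  along-inverse : ∀ {f g} → (∀ i → f (g i) ≡ i) → ∀ y → along f (along g y) ≡ y
  along-inverse {f} {g} f∘g≗id y with image? y
  ... | inj₁ (i , refl) = trans (along-image f (g i)) (cong c (f∘g≗id i))
  ... | inj₂ c∌y        = along-outside f c∌y

  extend : Permutation′ m → Permutation′ N
  extend ρ = permutation (along (ρ ⟨$⟩ʳ_)) (along (ρ ⟨$⟩ˡ_))
                         (along-inverse λ _ → inverseʳ ρ) (along-inverse λ _ → inverseˡ ρ)

-- i ↦ i + 1 mod k + 1
rotate : ∀ {k} → Permutation′ (suc k)
rotate {k} = insert (fromℕ k) zero idₚ

punchIn-fromℕ : ∀ {k} (i : Fin k) → punchIn (fromℕ k) i ≡ inject₁ i
punchIn-fromℕ zero    = refl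
punchIn-fromℕ (suc i) = cong suc (punchIn-fromℕ i)

rotate-inject₁ : ∀ {k} (i : Fin k) → rotate ⟨$⟩ʳ inject₁ i ≡ suc i
rotate-inject₁ {k} i = trans (cong (rotate ⟨$⟩ʳ_) (sym (punchIn-fromℕ i))) (insert-punchIn (fromℕ k) zero idₚ i)

rotate-fromℕ : ∀ k → rotate ⟨$⟩ʳ fromℕ k ≡ zero
rotate-fromℕ k with fromℕ k ≟ fromℕ k
... | yes _            = refl
... | no last≢last = ⊥-elim (last≢last refl)

rotate-suc : ∀ {k} (i j : Fin (suc k)) → toℕ j ≡ suc (toℕ i) → rotate ⟨$⟩ʳ i ≡ j
rotate-suc {k} i j j≡1+i with view i
... | ‵fromℕ           = ⊥-elim (ℕ.<⇒≢ (toℕ<n j) (trans j≡1+i (cong suc (toℕ-fromℕ k))))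
... | ‵inj₁ {i = i′} _ = trans (rotate-inject₁ i′) (toℕ-injective (trans (cong suc (sym (toℕ-inject₁ i′))) (sym j≡1+i)))

rotate-≢ : ∀ {k} (i : Fin (suc (suc k))) → rotate ⟨$⟩ʳ i ≢ i
rotate-≢ {k} i with view i
... | ‵fromℕ           = λ eq → ℕ.0≢1+n (cong toℕ (trans (sym (rotate-fromℕ (suc k))) eq))
... | ‵inj₁ {i = i′} _ = λ eq → ℕ.1+n≢n (trans (cong toℕ (trans (sym (rotate-inject₁ i′)) eq)) (toℕ-inject₁ i′))

module VecCycle {k N : ℕ} (xs : Vec (Fin N) (suc k)) (xs-unique : Unique xs) where

  open Along (lookup xs) (Uniqueₚ.lookup-injective xs-unique _ _) using (image?; along-image; along-outside; extend)

  -- Kept abstract: unfolding the cycle during type checking is very expensive.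
  abstract
    cycle : Permutation′ N
    cycle = extend rotate

    cycle-lookup : ∀ i → cycle ⟨$⟩ʳ lookup xs i ≡ lookup xs (rotate ⟨$⟩ʳ i)
    cycle-lookup = along-image (rotate ⟨$⟩ʳ_)

    cycle-outside : ∀ {x} → (∀ i → lookup xs i ≢ x) → cycle ⟨$⟩ʳ x ≡ x
    cycle-outside = along-outside (rotate ⟨$⟩ʳ_)

    cycle-support : ∀ {x} → Moves cycle x → x ∈ xs
    cycle-support {x} moves =
      [ (λ (i , xᵢ≡x) → subst (_∈ xs) xᵢ≡x (∈-lookup i xs))
      , (λ xs∌x → ⊥-elim (moves (along-outside (rotate ⟨$⟩ʳ_) xs∌x))) ]′ (image? x)

  cycle-∉ : ∀ {x} → x ∉ xs → cycle ⟨$⟩ʳ x ≡ x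
  cycle-∉ x∉xs = cycle-outside λ i xᵢ≡x → x∉xs (subst (_∈ xs) xᵢ≡x (∈-lookup i xs))

  cycle-isCycle : IsCycle (suc k) cycle
  cycle-isCycle = lookup xs , Uniqueₚ.lookup-injective xs-unique _ _
    , (λ i j j≡1+i → trans (cycle-lookup i) (cong (lookup xs) (rotate-suc i j j≡1+i)))
    , (λ i j 1+i≡1+k j≡0 → trans (cycle-lookup i) (cong (lookup xs) (begin
          rotate ⟨$⟩ʳ i       ≡⟨ cong (rotate ⟨$⟩ʳ_) (toℕ-injective (trans (ℕ.suc-injective 1+i≡1+k) (sym (toℕ-fromℕ k)))) ⟩
          rotate ⟨$⟩ʳ fromℕ k ≡⟨ rotate-fromℕ k ⟩
          zero                ≡⟨ toℕ-injective (sym j≡0) ⟩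
          j                   ∎)))
    , λ x xs∌x → cycle-outside xs∌x
    where open ≡-Reasoning

  cycle-adjacent : ∀ {x y} → Adjacent x y xs → cycle ⟨$⟩ʳ x ≡ y
  cycle-adjacent adj with Adjacent-index adj
  ... | i , refl , refl = trans (cycle-lookup (inject₁ i)) (cong (lookup xs) (rotate-inject₁ i))

  cycle-last : cycle ⟨$⟩ʳ last xs ≡ lookup xs zero
  cycle-last = begin
    cycle ⟨$⟩ʳ last xs              ≡⟨ cong (cycle ⟨$⟩ʳ_) (lookup-fromℕ xs) ⟨
    cycle ⟨$⟩ʳ lookup xs (fromℕ k)  ≡⟨ cycle-lookup (fromℕ k) ⟩
    lookup xs (rotate ⟨$⟩ʳ fromℕ k) ≡⟨ cong (lookup xs) (rotate-fromℕ k) ⟩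
    lookup xs zero                  ∎
    where open ≡-Reasoning

cycle-moves : ∀ {k N} (xs : Vec (Fin N) (suc (suc k))) (xs-unique : Unique xs) {x} →
              x ∈ xs → Moves (VecCycle.cycle xs xs-unique) x
cycle-moves xs xs-unique x∈xs with index x∈xs | Anyₚ.lookup-index x∈xs
... | i | refl = λ eq → rotate-≢ i (Uniqueₚ.lookup-injective xs-unique _ _ (trans (sym (cycle-lookup i)) eq))
  where open VecCycle xs xs-unique

module Points (n d : ℕ) where

  old : Fin n → Fin (n + d)
  old w = w ↑ˡ d

  new : Fin d → Fin (n + d)
  new j = n ↑ʳ j

  old≢new : ∀ w j → old w ≢ new j
  old≢new w j eq = ℕ.<⇒≱ (toℕ<n w) (begin
    n            ≤⟨ ℕ.m≤m+n n (toℕ j) ⟩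
    n + toℕ j    ≡⟨ toℕ-↑ʳ n j ⟨
    toℕ (new j)  ≡⟨ cong toℕ eq ⟨
    toℕ (old w)  ≡⟨ toℕ-↑ˡ w d ⟩
    toℕ w        ∎)
    where open ℕ.≤-Reasoning

  new∉map-new : ∀ {l} {z} {zs : Vec (Fin d) l} → z ∉ zs → new z ∉ map new zs
  new∉map-new z∉zs p = z∉zs (Any.map (↑ʳ-injective n _ _) (Anyₚ.map⁻ p))

  old∉map-new : ∀ {l} w (zs : Vec (Fin d) l) → old w ∉ map new zs
  old∉map-new w zs p with satisfied (Anyₚ.map⁻ p)
  ... | z , eq = old≢new w z eq

  module CycleThrough (u v : Fin n) (u≢v : u ≢ v) {l} (zs : Vec (Fin d) (suc l)) (zs-unique : Unique zs) where

    points : Vec (Fin (n + d)) (suc (suc (suc l)))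
    points = old u ∷ old v ∷ map new zs

    points-unique : Unique points
    points-unique = (u≢v ∘ ↑ˡ-injective d u v ∷ Allₚ.map⁺ (universal (old≢new u) zs))
                  ∷ Allₚ.map⁺ (universal (old≢new v) zs)
                  ∷ Uniqueₚ.map⁺ (↑ʳ-injective n _ _) zs-unique

    open VecCycle points points-unique

    μ : Permutation′ (n + d)
    μ = cycle

    isCycle : IsCycle (suc (suc (suc l))) μ
    isCycle = cycle-isCycle

    μ-u : μ ⟨$⟩ʳ old u ≡ old v
    μ-u = cycle-adjacent here

    μ-v : ∀ {z} → head zs ≡ z → μ ⟨$⟩ʳ old v ≡ new z
    μ-v refl = trans (cycle-adjacent (there (Adjacent-head (old v) (map new zs)))) (head-map new zs)

    μ-new : ∀ {z z′} → Adjacent z z′ zs → μ ⟨$⟩ʳ new z ≡ new z′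
    μ-new adj = cycle-adjacent (there (there (Adjacent-map new adj)))

    μ-last : ∀ {z} → last zs ≡ z → μ ⟨$⟩ʳ new z ≡ old u
    μ-last refl = trans (cong (μ ⟨$⟩ʳ_) (sym (last-map new zs))) cycle-last

    μ-old : ∀ {w} → w ≢ u → w ≢ v → μ ⟨$⟩ʳ old w ≡ old w
    μ-old {w} w≢u w≢v = cycle-∉ λ
      { (here eq)         → w≢u (↑ˡ-injective d w u eq)
      ; (there (here eq)) → w≢v (↑ˡ-injective d w v eq)
      ; (there (there p)) → old∉map-new w zs p }

    μ-new-∉ : ∀ {z} → z ∉ zs → μ ⟨$⟩ʳ new z ≡ new z
    μ-new-∉ {z} z∉zs = cycle-∉ λ
      { (here eq)         → old≢new u z (sym eq)
      ; (there (here eq)) → old≢new v z (sym eq)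
      ; (there (there p)) → new∉map-new z∉zs p }

    moves-u : Moves μ (old u)
    moves-u = cycle-moves points points-unique (here refl)

    moves-v : Moves μ (old v)
    moves-v = cycle-moves points points-unique (there (here refl))

    moves-new : ∀ {z} → z ∈ zs → Moves μ (new z)
    moves-new z∈zs = cycle-moves points points-unique (there (there (Anyₚ.map⁺ (Any.map (cong new) z∈zs))))

    moved-old : ∀ {w} → Moves μ (old w) → w ≡ u ⊎ w ≡ v
    moved-old {w} moves with cycle-support moves
    ... | here eq         = inj₁ (↑ˡ-injective d w u eq)
    ... | there (here eq) = inj₂ (↑ˡ-injective d w v eq)
    ... | there (there p) = ⊥-elim (old∉map-new w zs p)

    notInSn : NotInSn n d μ
    notInSn = head zs , moves-new (head∈ zs)
      where
      head∈ : ∀ {k} (ys : Vec (Fin d) (suc k)) → head ys ∈ ys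
      head∈ (_ ∷ _) = here refl

-- Decompositions into m-cycles with distinct supports

SameSupport-sym : ∀ {N} {μ ν : Permutation′ N} → SameSupport μ ν → SameSupport ν μ
SameSupport-sym same x = mk⇔ (Equivalence.from (same x)) (Equivalence.to (same x))

¬SameSupport : ∀ {N} {μ ν : Permutation′ N} x → Moves μ x → ¬ Moves ν x → ¬ SameSupport μ ν
¬SameSupport x μ-moves ν-fixes same = ν-fixes (Equivalence.to (same x) μ-moves)

apart : ∀ {N} {μ ν : Permutation′ N} x → Moves μ x → ¬ Moves ν x → ¬ SameSupport μ ν × ¬ SameSupport ν μ
apart {μ = μ} {ν} x μ-moves ν-fixes = μ≉ν , μ≉ν ∘ SameSupport-sym {μ = ν} {ν = μ}
  where
  μ≉ν = ¬SameSupport {μ = μ} {ν} x μ-moves ν-fixes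

prodApp-cong : ∀ {N} r {μ ν : Fin r → Permutation′ N} → (∀ i → μ i ≡ ν i) → ∀ x → prodApp r μ x ≡ prodApp r ν x
prodApp-cong zero    μ≗ν x = refl
prodApp-cong (suc r) μ≗ν x = cong₂ _⟨$⟩ʳ_ (μ≗ν zero) (prodApp-cong r (μ≗ν ∘ suc) x)

prodApp-++ : ∀ {N} k {r} (ν : Fin k → Permutation′ N) (μ : Fin r → Permutation′ N) x →
             prodApp (k + r) (ν Vector.++ μ) x ≡ prodApp k ν (prodApp r μ x)
prodApp-++ zero    ν μ x = refl
prodApp-++ (suc k) ν μ x = cong (ν zero ⟨$⟩ʳ_) (begin
  prodApp (k + _) (λ i → (ν Vector.++ μ) (suc i)) x ≡⟨ prodApp-cong (k + _) (λ i → [,]-map (splitAt k i)) x ⟩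
  prodApp (k + _) ((ν ∘ suc) Vector.++ μ) x         ≡⟨ prodApp-++ k (ν ∘ suc) μ x ⟩
  prodApp k (ν ∘ suc) (prodApp _ μ x)               ∎)
  where open ≡-Reasoning

prodApp-fixes : ∀ {N} r (μ : Fin r → Permutation′ N) {x} → (∀ i → ¬ Moves (μ i) x) → prodApp r μ x ≡ x
prodApp-fixes zero    μ fixes = refl
prodApp-fixes (suc r) μ {x} fixes = begin
  μ zero ⟨$⟩ʳ prodApp r (μ ∘ suc) x ≡⟨ cong (μ zero ⟨$⟩ʳ_) (prodApp-fixes r (μ ∘ suc) (fixes ∘ suc)) ⟩
  μ zero ⟨$⟩ʳ x                     ≡⟨ decidable-stable (μ zero ⟨$⟩ʳ x ≟ x) (fixes zero) ⟩
  x                                 ∎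
  where open ≡-Reasoning

either-below : ∀ {n b} {u v w : Fin n} → toℕ u < b → toℕ v < b → w ≡ u ⊎ w ≡ v → toℕ w < b
either-below u<b _   (inj₁ refl) = u<b
either-below _   v<b (inj₂ refl) = v<b

FixesFrom : ∀ {n} → ℕ → Permutation′ n → Set
FixesFrom b π = ∀ x → b ≤ toℕ x → π ⟨$⟩ʳ x ≡ x

image-below : ∀ {n b} {p : Fin n} (π : Permutation′ n) → FixesFrom (suc b) π → toℕ p ≡ b → π ⟨$⟩ʳ p ≢ p →
              toℕ (π ⟨$⟩ʳ p) < b
image-below {b = b} {p} π fixes p≡b πp≢p with ℕ.<-cmp (toℕ (π ⟨$⟩ʳ p)) b
... | tri< πp<b _ _ = πp<b
... | tri≈ _ πp≡b _ = ⊥-elim (πp≢p (toℕ-injective (trans πp≡b (sym p≡b))))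
... | tri> _ _ πp>b = ⊥-elim (πp≢p (⟨$⟩ʳ-injective π (fixes (π ⟨$⟩ʳ p) πp>b)))

FixesFrom-pivot : ∀ {n b} {p : Fin n} {π : Permutation′ n} →
                  toℕ p ≡ b → π ⟨$⟩ʳ p ≡ p → FixesFrom (suc b) π → FixesFrom b π
FixesFrom-pivot {p = p} {π} p≡b πp≡p fixes x b≤x with ℕ.m≤n⇒m<n∨m≡n b≤x
... | inj₁ b<x = fixes x b<x
... | inj₂ b≡x with toℕ-injective (trans p≡b b≡x)
...   | refl = πp≡p

-- π ∘ₚ flip τ is τ⁻¹ π; it also fixes the pivot when τ agrees with π there.
FixesFrom-reduce : ∀ {n b} {p : Fin n} {τ π : Permutation′ n} → (∀ z → b < toℕ z → τ ⟨$⟩ʳ z ≡ z) →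
                   toℕ p ≡ b → τ ⟨$⟩ʳ p ≡ π ⟨$⟩ʳ p → FixesFrom (suc b) π → FixesFrom b (π ∘ₚ flip τ)
FixesFrom-reduce {p = p} {τ} {π} τ-fixes p≡b τp≡πp fixes =
  FixesFrom-pivot {p = p} {π ∘ₚ flip τ} p≡b τ⁻¹πp≡p fixes′
  where
  τ⁻¹πp≡p : τ ⟨$⟩ˡ (π ⟨$⟩ʳ p) ≡ p
  τ⁻¹πp≡p = trans (cong (τ ⟨$⟩ˡ_) (sym τp≡πp)) (inverseˡ τ)
  fixes′ : FixesFrom (suc _) (π ∘ₚ flip τ)
  fixes′ x b<x = trans (cong (τ ⟨$⟩ˡ_) (trans (fixes x b<x) (sym (τ-fixes x b<x)))) (inverseˡ τ)

FixesFrom-one : ∀ {n} {π : Permutation′ n} → FixesFrom 1 π → π ≈ idₚ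
FixesFrom-one {π = π} fixes x with toℕ x ℕ.≟ 0 | toℕ (π ⟨$⟩ʳ x) ℕ.≟ 0
... | no x≢0  | _        = fixes x (ℕ.n≢0⇒n>0 x≢0)
... | yes x≡0 | yes πx≡0 = toℕ-injective (trans πx≡0 (sym x≡0))
... | yes x≡0 | no πx≢0  =
  ⊥-elim (πx≢0 (trans (cong toℕ (⟨$⟩ʳ-injective π (fixes (π ⟨$⟩ʳ x) (ℕ.n≢0⇒n>0 πx≢0)))) x≡0))

module Assembly (m n d : ℕ) where

  open Points n d

  record Good {r} (μ : Fin r → Permutation′ (n + d)) (b : ℕ) : Set where
    field
      isCycle  : ∀ i → IsCycle m (μ i)
      notInSn  : ∀ i → NotInSn n d (μ i)
      distinct : ∀ i j → i ≢ j → ¬ SameSupport (μ i) (μ j)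
      bounded  : ∀ i w → Moves (μ i) (old w) → toℕ w < b

  Realises : ∀ {r} → (Fin r → Permutation′ (n + d)) → Permutation′ n → Set
  Realises {r} μ π = (∀ a → prodApp r μ (old a) ≡ old (π ⟨$⟩ʳ a)) × (∀ x → prodApp r μ (new x) ≡ new x)

  record Decomposition (π : Permutation′ n) (b : ℕ) : Set where
    field
      {length} : ℕ
      factors  : Fin length → Permutation′ (n + d)
      good     : Good factors b
      realises : Realises factors π

  record Gadget (b : ℕ) (p : Fin n) (τ : Permutation′ n) : Set where
    field
      decomposition : Decomposition τ (suc b)
      movesPivot    : ∀ i → Moves (Decomposition.factors decomposition i) (old p)

  open Good
  open Decomposition

  Good-weaken : ∀ {r} {μ : Fin r → Permutation′ (n + d)} {b b′} → b ≤ b′ → Good μ b → Good μ b′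
  Good-weaken b≤b′ good = record
    { isCycle  = isCycle good
    ; notInSn  = notInSn good
    ; distinct = distinct good
    ; bounded  = λ i w moves → ℕ.<-≤-trans (bounded good i w moves) b≤b′
    }

  -- The factors of ν all move a_p, those of μ do not; so no support is shared.
  Good-++ : ∀ {k r b p} {ν : Fin k → Permutation′ (n + d)} {μ : Fin r → Permutation′ (n + d)} →
            toℕ p ≡ b → Good ν (suc b) → (∀ i → Moves (ν i) (old p)) → Good μ b → Good (ν Vector.++ μ) (suc b)
  Good-++ {k} {r} {b} {p} {ν} {μ} p≡b goodν pivot goodμ = record
    { isCycle  = isCycle′ ∘ splitAt k
    ; notInSn  = notInSn′ ∘ splitAt k
    ; distinct = λ i j i≢j → distinct′ (splitAt k i) (splitAt k j) (i≢j ∘ splitAt-injective i j)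
    ; bounded  = bounded′ ∘ splitAt k
    }
    where
    factor = [ ν , μ ]′
    splitAt-injective : ∀ i j → splitAt k i ≡ splitAt k j → i ≡ j
    splitAt-injective i j eq = trans (sym (join-splitAt k r i)) (trans (cong (join k r) eq) (join-splitAt k r j))
    μ-fixes-pivot : ∀ j → ¬ Moves (μ j) (old p)
    μ-fixes-pivot j moves = ℕ.<-irrefl p≡b (bounded goodμ j p moves)
    isCycle′ : ∀ s → IsCycle m (factor s)
    isCycle′ (inj₁ i) = isCycle goodν i
    isCycle′ (inj₂ j) = isCycle goodμ j
    notInSn′ : ∀ s → NotInSn n d (factor s)
    notInSn′ (inj₁ i) = notInSn goodν i
    notInSn′ (inj₂ j) = notInSn goodμ j
    distinct′ : ∀ s t → s ≢ t → ¬ SameSupport (factor s) (factor t)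
    distinct′ (inj₁ i) (inj₁ i′) s≢t = distinct goodν i i′ (s≢t ∘ cong inj₁)
    distinct′ (inj₁ i) (inj₂ j)  _   = proj₁ (apart {μ = ν i} {μ j} (old p) (pivot i) (μ-fixes-pivot j))
    distinct′ (inj₂ j) (inj₁ i)  _   = proj₂ (apart {μ = ν i} {μ j} (old p) (pivot i) (μ-fixes-pivot j))
    distinct′ (inj₂ j) (inj₂ j′) s≢t = distinct goodμ j j′ (s≢t ∘ cong inj₂)
    bounded′ : ∀ s w → Moves (factor s) (old w) → toℕ w < suc b
    bounded′ (inj₁ i) = bounded goodν i
    bounded′ (inj₂ j) w moves = ℕ.m<n⇒m<1+n (bounded goodμ j w moves)

  gadget-fixes : ∀ {b p τ} → Gadget b p τ → ∀ z → b < toℕ z → τ ⟨$⟩ʳ z ≡ z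
  gadget-fixes {b} {τ = τ} gadget z b<z = ↑ˡ-injective d _ _ (begin
    old (τ ⟨$⟩ʳ z)              ≡⟨ proj₁ (realises D) z ⟨
    prodApp (length D) (factors D) (old z) ≡⟨ prodApp-fixes (length D) (factors D) fixes ⟩
    old z                       ∎)
    where
    open ≡-Reasoning
    D = Gadget.decomposition gadget
    fixes : ∀ i → ¬ Moves (factors D i) (old z)
    fixes i moves = ℕ.<⇒≱ (bounded (good D) i z moves) b<z

  extendByGadget : ∀ {b p τ π} → toℕ p ≡ b → Gadget b p τ → Decomposition (π ∘ₚ flip τ) b → Decomposition π (suc b)
  extendByGadget {τ = τ} {π} p≡b gadget D = record
    { factors  = factors G Vector.++ factors D
    ; good     = Good-++ p≡b (good G) (Gadget.movesPivot gadget) (good D)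
    ; realises = realises-old , realises-new
    }
    where
    open ≡-Reasoning
    G = Gadget.decomposition gadget
    realises-old : ∀ a → prodApp _ (factors G Vector.++ factors D) (old a) ≡ old (π ⟨$⟩ʳ a)
    realises-old a = begin
      prodApp _ (factors G Vector.++ factors D) (old a)              ≡⟨ prodApp-++ (length G) (factors G) (factors D) (old a) ⟩
      prodApp _ (factors G) (prodApp _ (factors D) (old a))   ≡⟨ cong (prodApp _ (factors G)) (proj₁ (realises D) a) ⟩
      prodApp _ (factors G) (old (τ ⟨$⟩ˡ (π ⟨$⟩ʳ a)))          ≡⟨ proj₁ (realises G) _ ⟩
      old (τ ⟨$⟩ʳ (τ ⟨$⟩ˡ (π ⟨$⟩ʳ a)))                         ≡⟨ cong old (inverseʳ τ) ⟩
      old (π ⟨$⟩ʳ a)                                          ∎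
    realises-new : ∀ x → prodApp _ (factors G Vector.++ factors D) (new x) ≡ new x
    realises-new x = begin
      prodApp _ (factors G Vector.++ factors D) (new x)              ≡⟨ prodApp-++ (length G) (factors G) (factors D) (new x) ⟩
      prodApp _ (factors G) (prodApp _ (factors D) (new x))   ≡⟨ cong (prodApp _ (factors G)) (proj₂ (realises D) x) ⟩
      prodApp _ (factors G) (new x)                           ≡⟨ proj₂ (realises G) x ⟩
      new x                                                   ∎

  trivialDecomposition : ∀ {π} → FixesFrom 0 π → Decomposition π 0
  trivialDecomposition {π} fixes = record
    { length   = 0
    ; factors  = λ ()
    ; good     = record { isCycle = λ () ; notInSn = λ () ; distinct = λ () ; bounded = λ () }
    ; realises = (λ a → cong old (sym (fixes a z≤n))) , λ x → refl
    }

  Decomposition-weaken : ∀ {π b b′} → b ≤ b′ → Decomposition π b → Decomposition π b′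
  Decomposition-weaken b≤b′ D = record { factors = factors D ; good = Good-weaken b≤b′ (good D) ; realises = realises D }

  module Descent (Invariant : Permutation′ n → Set)
    (gadget-step : ∀ {b π} (p : Fin n) → toℕ p ≡ b → π ⟨$⟩ʳ p ≢ p → FixesFrom (suc b) π → Invariant π →
                   Σ (Permutation′ n) λ τ → Gadget b p τ × τ ⟨$⟩ʳ p ≡ π ⟨$⟩ʳ p × Invariant (π ∘ₚ flip τ))
    where

    decompose : ∀ b π → FixesFrom b π → Invariant π → Decomposition π b
    decompose zero    π fixes invariant = trivialDecomposition fixes
    decompose (suc b) π fixes invariant with b ℕ.<? n
    ... | no b≮n = Decomposition-weaken (ℕ.n≤1+n b)
                     (decompose b π (λ x b≤x → ⊥-elim (b≮n (ℕ.≤-<-trans b≤x (toℕ<n x)))) invariant)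
    ... | yes b<n = decomposeAt (fromℕ< b<n) (toℕ-fromℕ< b<n)
      where
      decomposeAt : ∀ p → toℕ p ≡ b → Decomposition π (suc b)
      decomposeAt p p≡b with π ⟨$⟩ʳ p ≟ p
      ... | yes πp≡p = Decomposition-weaken (ℕ.n≤1+n b) (decompose b π (FixesFrom-pivot {p = p} {π} p≡b πp≡p fixes) invariant)
      ... | no πp≢p with gadget-step p p≡b πp≢p fixes invariant
      ...   | τ , gadget , τp≡πp , invariant′ =
              extendByGadget p≡b gadget
                (decompose b (π ∘ₚ flip τ) (FixesFrom-reduce {τ = τ} {π} (gadget-fixes gadget) p≡b τp≡πp fixes) invariant′)

    decomposition : ∀ π → Invariant π → Decomposition π n
    decomposition π = decompose n π (λ x n≤x → ⊥-elim (ℕ.<⇒≱ (toℕ<n x) n≤x))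

-- The gadgets

threeCycle : ∀ {n} → Fin n → Fin n → Fin n → Permutation′ n
threeCycle o p q = transpose o q ∘ₚ transpose p q

parity-threeCycle : ∀ {n} {o p q : Fin n} → o ≢ q → p ≢ q → parity (threeCycle o p q) ≡ false
parity-threeCycle {o = o} {p} {q} o≢q p≢q =
  trans (parity-∘ (transpose o q) (transpose p q)) (cong₂ _xor_ (parity-transpose o≢q) (parity-transpose p≢q))

-- With d = d′ + 1 new points, (a_o a_p x₀ … x_{d′}) (a_p a_q x_{d′} … x₀) = (a_o a_p a_q).
module OddGadget (n d′ : ℕ) where

  open Points n (suc d′)
  open Assembly (suc (suc (suc d′))) n (suc d′)

  module _ {o p q : Fin n} (o≢p : o ≢ p) (o≢q : o ≢ q) (p≢q : p ≢ q) where

    private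
      module M₁ = CycleThrough o p o≢p (tabulate id) (Uniqueₚ.tabulate⁺ id)
      module M₂ = CycleThrough p q p≢q (tabulate opposite) (Uniqueₚ.tabulate⁺ opposite-injective)

    oddCycles : Fin 2 → Permutation′ (n + suc d′)
    oddCycles zero       = M₁.μ
    oddCycles (suc zero) = M₂.μ

    private
      trace : ∀ {x y z} → M₂.μ ⟨$⟩ʳ x ≡ y → M₁.μ ⟨$⟩ʳ y ≡ z → prodApp 2 oddCycles x ≡ z
      trace refl refl = refl

    oddCycles-old : ∀ z → prodApp 2 oddCycles (old z) ≡ old (threeCycle o p q ⟨$⟩ʳ z)
    oddCycles-old z = by-cases (z ≟ o) (z ≟ p) (z ≟ q)
      where
      by-cases : Dec (z ≡ o) → Dec (z ≡ p) → Dec (z ≡ q) → prodApp 2 oddCycles (old z) ≡ old (threeCycle o p q ⟨$⟩ʳ z)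
      by-cases (yes refl) _ _ = trans (trace (M₂.μ-old o≢p o≢q) M₁.μ-u)
        (cong old (sym (trans (cong (transpose p q ⟨$⟩ʳ_) (transpose-≡ˡ z q)) (transpose-≡ʳ p q))))
      by-cases (no _) (yes refl) _ = trans (trace M₂.μ-u (M₁.μ-old (o≢q ∘ sym) (p≢q ∘ sym)))
        (cong old (sym (trans (cong (transpose z q ⟨$⟩ʳ_) (transpose-≢ (o≢p ∘ sym) p≢q)) (transpose-≡ˡ z q))))
      by-cases (no _) (no _) (yes refl) = trans (trace (M₂.μ-v refl) (M₁.μ-last (last-tabulate id)))
        (cong old (sym (trans (cong (transpose p z ⟨$⟩ʳ_) (transpose-≡ʳ o z)) (transpose-≢ o≢p o≢q))))
      by-cases (no z≢o) (no z≢p) (no z≢q) = trans (trace (M₂.μ-old z≢p z≢q) (M₁.μ-old z≢o z≢p))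
        (cong old (sym (trans (cong (transpose p q ⟨$⟩ʳ_) (transpose-≢ z≢o z≢q)) (transpose-≢ z≢p z≢q))))

    oddCycles-new : ∀ x → prodApp 2 oddCycles (new x) ≡ new x
    oddCycles-new zero    = trace (M₂.μ-last (trans (last-tabulate opposite) (opposite-fromℕ d′))) (M₁.μ-v refl)
    oddCycles-new (suc s) = trace (M₂.μ-new (Adjacent-tabulate-opposite id s)) (M₁.μ-new (Adjacent-tabulate id s))

    oddCycles-pivot : ∀ i → Moves (oddCycles i) (old p)
    oddCycles-pivot zero       = M₁.moves-v
    oddCycles-pivot (suc zero) = M₂.moves-u

    oddCycles-good : ∀ {b} → toℕ o < b → toℕ p < b → toℕ q < b → Good oddCycles b
    oddCycles-good o<b p<b q<b = record
      { isCycle  = λ { zero → M₁.isCycle ; (suc zero) → M₂.isCycle }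
      ; notInSn  = λ { zero → M₁.notInSn ; (suc zero) → M₂.notInSn }
      ; distinct = distinct
      ; bounded  = λ { zero _ moves → either-below o<b p<b (M₁.moved-old moves)
                     ; (suc zero) _ moves → either-below p<b q<b (M₂.moved-old moves) }
      }
      where
      apart₁₂ : ¬ SameSupport M₁.μ M₂.μ × ¬ SameSupport M₂.μ M₁.μ
      apart₁₂ = apart {μ = M₁.μ} {M₂.μ} (old o) M₁.moves-u λ moves → moves (M₂.μ-old o≢p o≢q)
      distinct : ∀ i j → i ≢ j → ¬ SameSupport (oddCycles i) (oddCycles j)
      distinct zero       zero       0≢0 = ⊥-elim (0≢0 refl)
      distinct zero       (suc zero) _   = proj₁ apart₁₂
      distinct (suc zero) zero       _   = proj₂ apart₁₂
      distinct (suc zero) (suc zero) 1≢1 = ⊥-elim (1≢1 refl)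

  oddGadget : ∀ {b o p q} → toℕ o < suc b → toℕ p ≡ b → toℕ q < suc b →
              o ≢ p → o ≢ q → p ≢ q → Gadget b p (threeCycle o p q)
  oddGadget o≤b p≡b q≤b o≢p o≢q p≢q = record
    { decomposition = record
      { factors  = oddCycles o≢p o≢q p≢q
      ; good     = oddCycles-good o≢p o≢q p≢q o≤b (ℕ.≤-reflexive (cong suc p≡b)) q≤b
      ; realises = oddCycles-old o≢p o≢q p≢q , oddCycles-new o≢p o≢q p≢q
      }
    ; movesPivot = oddCycles-pivot o≢p o≢q p≢q
    }

-- With d = 3K new points x_{β,s} (β < 3, s < K) arranged in three rows, the product
--   (a_p a_q  row 0 ascending, row 1 ascending) (a_q a_p  row 2 ascending, row 0 descending)
--   (a_p a_q  row 1 descending, row 2 descending)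
-- is the transposition (a_p a_q).
module EvenGadget (n k : ℕ) where

  K = suc k

  open Points n (3 * K)
  open Assembly (suc (suc (K + K))) n (3 * K)

  cell : Fin 3 → Fin K → Fin (3 * K)
  cell = combine

  ascending descending : Fin 3 → Vec (Fin (3 * K)) K
  ascending  β = tabulate (cell β)
  descending β = tabulate (cell β ∘ opposite)

  last-ascending : ∀ β → last (ascending β) ≡ cell β (fromℕ k)
  last-ascending β = last-tabulate (cell β)

  last-descending : ∀ β → last (descending β) ≡ cell β zero
  last-descending β = trans (last-tabulate (cell β ∘ opposite)) (cong (cell β) (opposite-fromℕ k))

  rows-unique : ∀ (β β′ : Fin 3) (f g : Fin K → Fin K) → β ≢ β′ → Injective _≡_ _≡_ f → Injective _≡_ _≡_ g →
                Unique (tabulate (cell β ∘ f) ++ tabulate (cell β′ ∘ g))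
  rows-unique β β′ f g β≢β′ f-injective g-injective = AllPairsₚ.++⁺
    (Uniqueₚ.tabulate⁺ (f-injective ∘ combine-injectiveʳ β _ β _))
    (Uniqueₚ.tabulate⁺ (g-injective ∘ combine-injectiveʳ β′ _ β′ _))
    (Allₚ.tabulate⁺ {f = cell β ∘ f} λ _ →
       Allₚ.tabulate⁺ {f = cell β′ ∘ g} λ _ eq → β≢β′ (combine-injectiveˡ β _ β′ _ eq))

  other-rows : ∀ (β′ β″ : Fin 3) (f g : Fin K → Fin K) (β : Fin 3) (s : Fin K) → β′ ≢ β → β″ ≢ β →
               cell β s ∉ tabulate (cell β′ ∘ f) ++ tabulate (cell β″ ∘ g)
  other-rows β′ β″ f g β s β′≢β β″≢β =
    ∉-++ (∉-tabulate {f = cell β′ ∘ f} λ _ eq → β′≢β (combine-injectiveˡ _ _ _ _ eq))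
         (∉-tabulate {f = cell β″ ∘ g} λ _ eq → β″≢β (combine-injectiveˡ _ _ _ _ eq))

  module _ {p q : Fin n} (p≢q : p ≢ q) where

    private
      ζ₁ ζ₂ ζ₃ : Vec (Fin (3 * K)) (K + K)
      ζ₁ = ascending 0F ++ ascending 1F
      ζ₂ = ascending 2F ++ descending 0F
      ζ₃ = descending 1F ++ descending 2F
      module M₁ = CycleThrough p q p≢q ζ₁ (rows-unique 0F 1F id id (λ ()) id id)
      module M₂ = CycleThrough q p (p≢q ∘ sym) ζ₂ (rows-unique 2F 0F id opposite (λ ()) id opposite-injective)
      module M₃ = CycleThrough p q p≢q ζ₃ (rows-unique 1F 2F opposite opposite (λ ()) opposite-injective opposite-injective)

      row2∉ζ₁ : ∀ s → cell 2F s ∉ ζ₁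
      row2∉ζ₁ s = other-rows 0F 1F id id 2F s (λ ()) (λ ())
      row1∉ζ₂ : ∀ s → cell 1F s ∉ ζ₂
      row1∉ζ₂ s = other-rows 2F 0F id opposite 1F s (λ ()) (λ ())
      row0∉ζ₃ : ∀ s → cell 0F s ∉ ζ₃
      row0∉ζ₃ s = other-rows 1F 2F opposite opposite 0F s (λ ()) (λ ())

    evenCycles : Fin 3 → Permutation′ (n + 3 * K)
    evenCycles zero             = M₁.μ
    evenCycles (suc zero)       = M₂.μ
    evenCycles (suc (suc zero)) = M₃.μ

    private
      trace : ∀ {x y z w} → M₃.μ ⟨$⟩ʳ x ≡ y → M₂.μ ⟨$⟩ʳ y ≡ z → M₁.μ ⟨$⟩ʳ z ≡ w →
              prodApp 3 evenCycles x ≡ w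
      trace refl refl refl = refl

    evenCycles-old : ∀ z → prodApp 3 evenCycles (old z) ≡ old (transpose p q ⟨$⟩ʳ z)
    evenCycles-old z = by-cases (z ≟ p) (z ≟ q)
      where
      by-cases : Dec (z ≡ p) → Dec (z ≡ q) → prodApp 3 evenCycles (old z) ≡ old (transpose p q ⟨$⟩ʳ z)
      by-cases (yes refl) _ = trans (trace M₃.μ-u M₂.μ-u M₁.μ-u) (cong old (sym (transpose-≡ˡ z q)))
      by-cases (no _) (yes refl) =
        trans (trace (M₃.μ-v refl) (M₂.μ-new-∉ (row1∉ζ₂ (fromℕ k)))
                     (M₁.μ-last (trans (last-++ (ascending 0F) (ascending 1F)) (last-ascending 1F))))
              (cong old (sym (transpose-≡ʳ p z)))
      by-cases (no z≢p) (no z≢q) =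
        trans (trace (M₃.μ-old z≢p z≢q) (M₂.μ-old z≢q z≢p) (M₁.μ-old z≢p z≢q))
              (cong old (sym (transpose-≢ z≢p z≢q)))

    evenCycles-cell : ∀ β s → prodApp 3 evenCycles (new (cell β s)) ≡ new (cell β s)
    evenCycles-cell 0F zero    = trace (M₃.μ-new-∉ (row0∉ζ₃ zero))
      (M₂.μ-last (trans (last-++ (ascending 2F) (descending 0F)) (last-descending 0F)))
      (M₁.μ-v refl)
    evenCycles-cell 0F (suc s) = trace (M₃.μ-new-∉ (row0∉ζ₃ (suc s)))
      (M₂.μ-new (Adjacent-++ʳ (ascending 2F) (Adjacent-tabulate-opposite (cell 0F) s)))
      (M₁.μ-new (Adjacent-++ˡ (ascending 1F) (Adjacent-tabulate (cell 0F) s)))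
    evenCycles-cell 1F zero    = trace
      (M₃.μ-new (Adjacent-junction (descending 1F) (descending 2F) (last-descending 1F) refl))
      (M₂.μ-new (Adjacent-junction (ascending 2F) (descending 0F) (last-ascending 2F) refl))
      (M₁.μ-new (Adjacent-junction (ascending 0F) (ascending 1F) (last-ascending 0F) refl))
    evenCycles-cell 1F (suc s) = trace
      (M₃.μ-new (Adjacent-++ˡ (descending 2F) (Adjacent-tabulate-opposite (cell 1F) s)))
      (M₂.μ-new-∉ (row1∉ζ₂ (inject₁ s)))
      (M₁.μ-new (Adjacent-++ʳ (ascending 0F) (Adjacent-tabulate (cell 1F) s)))
    evenCycles-cell 2F zero    = trace
      (M₃.μ-last (trans (last-++ (descending 1F) (descending 2F)) (last-descending 2F)))
      (M₂.μ-v refl)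
      (M₁.μ-new-∉ (row2∉ζ₁ zero))
    evenCycles-cell 2F (suc s) = trace
      (M₃.μ-new (Adjacent-++ʳ (descending 1F) (Adjacent-tabulate-opposite (cell 2F) s)))
      (M₂.μ-new (Adjacent-++ˡ (descending 0F) (Adjacent-tabulate (cell 2F) s)))
      (M₁.μ-new-∉ (row2∉ζ₁ (suc s)))

    evenCycles-new : ∀ x → prodApp 3 evenCycles (new x) ≡ new x
    evenCycles-new x = subst (λ y → prodApp 3 evenCycles (new y) ≡ new y) (combine-remQuot {3} K x)
                             (evenCycles-cell (proj₁ (remQuot {3} K x)) (proj₂ (remQuot {3} K x)))

    evenCycles-pivot : ∀ i → Moves (evenCycles i) (old p)
    evenCycles-pivot zero             = M₁.moves-u
    evenCycles-pivot (suc zero)       = M₂.moves-v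
    evenCycles-pivot (suc (suc zero)) = M₃.moves-u

    evenCycles-good : ∀ {b} → toℕ p < b → toℕ q < b → Good evenCycles b
    evenCycles-good p<b q<b = record
      { isCycle  = λ { zero → M₁.isCycle ; (suc zero) → M₂.isCycle ; (suc (suc zero)) → M₃.isCycle }
      ; notInSn  = λ { zero → M₁.notInSn ; (suc zero) → M₂.notInSn ; (suc (suc zero)) → M₃.notInSn }
      ; distinct = distinct
      ; bounded  = λ { zero _ moves → either-below p<b q<b (M₁.moved-old moves)
                     ; (suc zero) _ moves → either-below q<b p<b (M₂.moved-old moves)
                     ; (suc (suc zero)) _ moves → either-below p<b q<b (M₃.moved-old moves) }
      }
      where
      apart₁₂ : ¬ SameSupport M₁.μ M₂.μ × ¬ SameSupport M₂.μ M₁.μ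
      apart₁₂ = apart {μ = M₁.μ} {M₂.μ} (new (cell 1F zero)) (M₁.moves-new (Anyₚ.++⁺ʳ (ascending 0F) (here refl)))
                      λ moves → moves (M₂.μ-new-∉ (row1∉ζ₂ zero))
      apart₁₃ : ¬ SameSupport M₁.μ M₃.μ × ¬ SameSupport M₃.μ M₁.μ
      apart₁₃ = apart {μ = M₁.μ} {M₃.μ} (new (cell 0F zero)) (M₁.moves-new (here refl))
                      λ moves → moves (M₃.μ-new-∉ (row0∉ζ₃ zero))
      apart₂₃ : ¬ SameSupport M₂.μ M₃.μ × ¬ SameSupport M₃.μ M₂.μ
      apart₂₃ = apart {μ = M₂.μ} {M₃.μ} (new (cell 0F (fromℕ k))) (M₂.moves-new (Anyₚ.++⁺ʳ (ascending 2F) (here refl)))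
                      λ moves → moves (M₃.μ-new-∉ (row0∉ζ₃ (fromℕ k)))
      distinct : ∀ i j → i ≢ j → ¬ SameSupport (evenCycles i) (evenCycles j)
      distinct zero             zero             0≢0 = ⊥-elim (0≢0 refl)
      distinct zero             (suc zero)       _   = proj₁ apart₁₂
      distinct zero             (suc (suc zero)) _   = proj₁ apart₁₃
      distinct (suc zero)       zero             _   = proj₂ apart₁₂
      distinct (suc zero)       (suc zero)       1≢1 = ⊥-elim (1≢1 refl)
      distinct (suc zero)       (suc (suc zero)) _   = proj₁ apart₂₃
      distinct (suc (suc zero)) zero             _   = proj₂ apart₁₃
      distinct (suc (suc zero)) (suc zero)       _   = proj₂ apart₂₃
      distinct (suc (suc zero)) (suc (suc zero)) 2≢2 = ⊥-elim (2≢2 refl)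

  evenGadget : ∀ {b p q} → toℕ p ≡ b → toℕ q < suc b → p ≢ q → Gadget b p (transpose p q)
  evenGadget p≡b q≤b p≢q = record
    { decomposition = record
      { factors  = evenCycles p≢q
      ; good     = evenCycles-good p≢q (ℕ.≤-reflexive (cong suc p≡b)) q≤b
      ; realises = evenCycles-old p≢q , evenCycles-new p≢q
      }
    ; movesPivot = evenCycles-pivot p≢q
    }

InH-parity : ∀ m {n} {σ : Permutation′ n} → isOdd m ≡ false → InH (suc m) σ → parity σ ≡ false
InH-parity m even (gen σ-cycle)           = trans (parity-cycle m σ-cycle) even
InH-parity m {n} even one                 = parity-id {n}
InH-parity m even (mul {σ} {τ} σ∈H τ∈H)   =
  trans (parity-∘ τ σ) (cong₂ _xor_ (InH-parity m even τ∈H) (InH-parity m even σ∈H))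
InH-parity m even (inv {σ} σ∈H)           = trans (parity-flip σ) (InH-parity m even σ∈H)
InH-parity m even (resp {σ} {τ} σ≈τ σ∈H) = trans (sym (parity-cong σ≈τ)) (InH-parity m even σ∈H)

-- Such a π is the transposition of the points of index 0 and 1.
parity-pivot-one : ∀ {n} {π : Permutation′ n} {p} → FixesFrom 2 π → toℕ p ≡ 1 → π ⟨$⟩ʳ p ≢ p → parity π ≡ true
parity-pivot-one {n} {π} {p} fixes p≡1 πp≢p = begin
  parity π                            ≡⟨ solve 1 (λ x → x := con true :+ (x :+ con true)) refl (parity π) ⟩
  not (parity π xor true)             ≡⟨ cong (λ t → not (parity π xor t)) (trans (parity-flip t) (parity-transpose p≢q)) ⟨
  not (parity π xor parity (flip t))  ≡⟨ cong not (parity-∘ π (flip t)) ⟨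
  not (parity (π ∘ₚ flip t))          ≡⟨ cong not (trans (parity-cong {ρ = idₚ {n}} t⁻¹π≈id) (parity-id {n})) ⟩
  true                                ∎
  where
  open ≡-Reasoning
  open BoolSolver
  q = π ⟨$⟩ʳ p
  t = transpose p q
  p≢q : p ≢ q
  p≢q = πp≢p ∘ sym
  q≡0 : toℕ q ≡ 0
  q≡0 = ℕ.n<1⇒n≡0 (image-below π fixes p≡1 πp≢p)
  t-fixes : ∀ z → 1 < toℕ z → t ⟨$⟩ʳ z ≡ z
  t-fixes z 1<z = transpose-≢ (λ z≡p → ℕ.<-irrefl (sym (trans (cong toℕ z≡p) p≡1)) 1<z)
                              (λ z≡q → ℕ.<⇒≢ (ℕ.<-trans (s≤s z≤n) 1<z) (sym (trans (cong toℕ z≡q) q≡0)))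
  t⁻¹π≈id : π ∘ₚ flip t ≈ idₚ
  t⁻¹π≈id = FixesFrom-one {π = π ∘ₚ flip t} (FixesFrom-reduce {τ = t} {π} t-fixes p≡1 (transpose-≡ˡ p q) fixes)

another-point-below : ∀ {n b} → b < n → 2 ≤ b → (q : Fin n) → Σ (Fin n) λ o → toℕ o < b × o ≢ q
another-point-below {b = b} b<n 2≤b q with toℕ q ℕ.≟ 0
... | yes q≡0 = fromℕ< 1<n , subst (_< b) (sym (toℕ-fromℕ< 1<n)) 2≤b
              , λ o≡q → ℕ.1+n≢0 (trans (sym (toℕ-fromℕ< 1<n)) (trans (cong toℕ o≡q) q≡0))
  where
  1<n = ℕ.<-trans 2≤b b<n
... | no q≢0  = fromℕ< 0<n , subst (_< b) (sym (toℕ-fromℕ< 0<n)) (ℕ.≤-trans (s≤s z≤n) 2≤b)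
              , λ o≡q → q≢0 (trans (cong toℕ (sym o≡q)) (toℕ-fromℕ< 0<n))
  where
  0<n = ℕ.<-trans (ℕ.≤-trans (s≤s z≤n) 2≤b) b<n

module OddCase (n d′ : ℕ) where

  open Assembly (suc (suc (suc d′))) n (suc d′)
  open OddGadget n d′

  oddStep : ∀ {b} {π : Permutation′ n} (p : Fin n) → toℕ p ≡ b → π ⟨$⟩ʳ p ≢ p → FixesFrom (suc b) π →
            parity π ≡ false →
            Σ (Permutation′ n) λ τ → Gadget b p τ × τ ⟨$⟩ʳ p ≡ π ⟨$⟩ʳ p × parity (π ∘ₚ flip τ) ≡ false
  oddStep {zero}        {π} p p≡0 πp≢p fixes _    = ⊥-elim (ℕ.n≮0 (image-below π fixes p≡0 πp≢p))
  oddStep {suc zero}    {π} p p≡1 πp≢p fixes even =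
    ⊥-elim (true≢false (trans (sym (parity-pivot-one {π = π} fixes p≡1 πp≢p)) even))
    where
    true≢false : true ≢ false
    true≢false ()
  oddStep {suc (suc b)} {π} p p≡b πp≢p fixes even
    with another-point-below (subst (_< n) p≡b (toℕ<n p)) (s≤s (s≤s z≤n)) (π ⟨$⟩ʳ p)
  ... | o , o<b , o≢q = threeCycle o p q
                      , oddGadget (ℕ.m<n⇒m<1+n o<b) p≡b (ℕ.m<n⇒m<1+n q<b) o≢p o≢q p≢q
                      , τp≡q
                      , parity-reduced
    where
    q = π ⟨$⟩ʳ p
    q<b = image-below π fixes p≡b πp≢p
    p≢q : p ≢ q
    p≢q = πp≢p ∘ sym
    o≢p : o ≢ p
    o≢p o≡p = ℕ.<-irrefl (trans (cong toℕ o≡p) p≡b) o<b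
    τp≡q : threeCycle o p q ⟨$⟩ʳ p ≡ q
    τp≡q = trans (cong (transpose p q ⟨$⟩ʳ_) (transpose-≢ (o≢p ∘ sym) p≢q)) (transpose-≡ˡ p q)
    parity-reduced : parity (π ∘ₚ flip (threeCycle o p q)) ≡ false
    parity-reduced = trans (parity-∘ π (flip (threeCycle o p q)))
      (cong₂ _xor_ even (trans (parity-flip (threeCycle o p q)) (parity-threeCycle o≢q p≢q)))

  open Descent (λ π → parity π ≡ false) oddStep public

module EvenCase (n k : ℕ) where

  open Assembly (suc (suc (suc k + suc k))) n (3 * suc k)
  open EvenGadget n k

  evenStep : ∀ {b} {π : Permutation′ n} (p : Fin n) → toℕ p ≡ b → π ⟨$⟩ʳ p ≢ p → FixesFrom (suc b) π →
             ⊤ → Σ (Permutation′ n) λ τ → Gadget b p τ × τ ⟨$⟩ʳ p ≡ π ⟨$⟩ʳ p × ⊤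
  evenStep {π = π} p p≡b πp≢p fixes _ =
    transpose p (π ⟨$⟩ʳ p) , evenGadget p≡b (ℕ.m<n⇒m<1+n (image-below π fixes p≡b πp≢p)) (πp≢p ∘ sym)
    , transpose-≡ˡ p (π ⟨$⟩ʳ p) , tt

  open Descent (λ _ → ⊤) (λ {b} {π} → evenStep {b} {π}) public

Conclusion : (m n d : ℕ) → Permutation′ n → Set
Conclusion m n d σ =
  Σ ℕ λ r → Σ (Fin r → Permutation′ (n + d)) λ μ →
      (∀ i → IsCycle m (μ i))
    × (∀ i → NotInSn n d (μ i))
    × (∀ i j → i ≢ j → ¬ SameSupport (μ i) (μ j))
    × (∀ (a : Fin n) → prodApp r μ (a ↑ˡ d) ≡ ((σ ⁻¹) ⟨$⟩ʳ a) ↑ˡ d)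
    × (∀ (x : Fin d) → prodApp r μ (n ↑ʳ x) ≡ n ↑ʳ x)

conclusion : ∀ {m n d b} {σ : Permutation′ n} → Assembly.Decomposition m n d (σ ⁻¹) b → Conclusion m n d σ
conclusion D = length D , factors D , isCycle (good D) , notInSn (good D) , distinct (good D) , realises D
  where
  open Assembly.Decomposition
  open Assembly.Good

isOdd-*2 : ∀ h → isOdd (h * 2) ≡ false
isOdd-*2 zero    = refl
isOdd-*2 (suc h) = trans (not-involutive (isOdd (h * 2))) (isOdd-*2 h)

suc-*2 : ∀ k → suc (k * 2) ≡ k + suc k
suc-*2 k = trans (cong suc (trans (ℕ.*-comm k 2) (cong (k +_) (ℕ.+-identityʳ k)))) (sym (ℕ.+-suc k k))

m%2≡0⊎m%2≡1 : ∀ m → m % 2 ≡ 0 ⊎ m % 2 ≡ 1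
m%2≡0⊎m%2≡1 m with m % 2 | m%n<n m 2
... | zero        | _ = inj₁ refl
... | suc zero    | _ = inj₂ refl
... | suc (suc _) | s≤s (s≤s ())

odd-shape : ∀ m → 3 ≤ m → m % 2 ≡ 1 →
            Σ ℕ λ d′ → m ≡ suc (suc (suc d′)) × dOf m ≡ suc d′ × isOdd (suc (suc d′)) ≡ false
odd-shape m 3≤m m%2≡1 = shape (m / 2) refl
  where
  m≡1+[m/2]*2 : m ≡ 1 + m / 2 * 2
  m≡1+[m/2]*2 = trans (m≡m%n+[m/n]*n m 2) (cong (_+ m / 2 * 2) m%2≡1)
  dOf-odd : dOf m ≡ m ∸ 2
  dOf-odd rewrite m%2≡1 = refl
  shape : ∀ h → m / 2 ≡ h → Σ ℕ λ d′ → m ≡ suc (suc (suc d′)) × dOf m ≡ suc d′ × isOdd (suc (suc d′)) ≡ false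
  shape zero    m/2≡0 with subst (3 ≤_) (trans m≡1+[m/2]*2 (cong (λ h → 1 + h * 2) m/2≡0)) 3≤m
  ... | s≤s ()
  shape (suc h) m/2≡1+h = h * 2 , m≡ , trans dOf-odd (cong (_∸ 2) m≡) , trans (not-involutive _) (isOdd-*2 h)
    where
    m≡ : m ≡ suc (suc (suc (h * 2)))
    m≡ = trans m≡1+[m/2]*2 (cong (λ h → 1 + h * 2) m/2≡1+h)

even-shape : ∀ m → 3 ≤ m → m % 2 ≡ 0 → Σ ℕ λ k → m ≡ suc (suc (suc k + suc k)) × dOf m ≡ 3 * suc k
even-shape m 3≤m m%2≡0 = shape (m / 2) refl
  where
  m≡[m/2]*2 : m ≡ m / 2 * 2
  m≡[m/2]*2 = trans (m≡m%n+[m/n]*n m 2) (cong (_+ m / 2 * 2) m%2≡0)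
  dOf-even : dOf m ≡ 3 * (m / 2 ∸ 1)
  dOf-even rewrite m%2≡0 = refl
  shape : ∀ h → m / 2 ≡ h → Σ ℕ λ k → m ≡ suc (suc (suc k + suc k)) × dOf m ≡ 3 * suc k
  shape zero          m/2≡0 with subst (3 ≤_) (trans m≡[m/2]*2 (cong (_* 2) m/2≡0)) 3≤m
  ... | ()
  shape (suc zero)    m/2≡1 with subst (3 ≤_) (trans m≡[m/2]*2 (cong (_* 2) m/2≡1)) 3≤m
  ... | s≤s (s≤s ())
  shape (suc (suc k)) m/2≡2+k = k , m≡ , trans dOf-even (cong (λ h → 3 * (h ∸ 1)) m/2≡2+k)
    where
    m≡ : m ≡ suc (suc (suc k + suc k))
    m≡ = trans m≡[m/2]*2 (trans (cong (_* 2) m/2≡2+k) (cong (λ j → suc (suc (suc j))) (suc-*2 k)))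

mainTheorem1 : (m n : ℕ) → 3 ≤ m → m ≤ n → (σ : Permutation′ n) → InH m σ →
    Σ ℕ λ r → Σ (Fin r → Permutation′ (n + dOf m)) λ μ →
        (∀ i → IsCycle m (μ i))
      × (∀ i → NotInSn n (dOf m) (μ i))
      × (∀ i j → i ≢ j → ¬ SameSupport (μ i) (μ j))
      × (∀ (a : Fin n) → prodApp r μ (a ↑ˡ dOf m) ≡ ((σ ⁻¹) ⟨$⟩ʳ a) ↑ˡ dOf m)
      × (∀ (x : Fin (dOf m)) → prodApp r μ (n ↑ʳ x) ≡ n ↑ʳ x)
mainTheorem1 m n 3≤m _ σ σ∈H with m%2≡0⊎m%2≡1 m
... | inj₁ m%2≡0 with even-shape m 3≤m m%2≡0
...   | k , m≡ , d≡ =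
  subst₂ (λ m d → Conclusion m n d σ) (sym m≡) (sym d≡) (conclusion (EvenCase.decomposition n k (σ ⁻¹) tt))
mainTheorem1 m n 3≤m _ σ σ∈H | inj₂ m%2≡1 with odd-shape m 3≤m m%2≡1
...   | d′ , m≡ , d≡ , m-1-even =
  subst₂ (λ m d → Conclusion m n d σ) (sym m≡) (sym d≡) (conclusion (OddCase.decomposition n d′ (σ ⁻¹) σ⁻¹-even))
  where
  σ⁻¹-even = trans (parity-flip σ) (InH-parity _ m-1-even (subst (λ m → InH m σ) m≡ σ∈H))
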